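{- There is no $n \geq 0$ such that $s(n), s(n+1), s(n+2), s(n+3), s(n+4)$ are all non-negative; that is, the infinity series never contains five or more consecutive non-negative terms.
   Context: The infinity series $(s(n))_{n \geq 0}$ is the integer sequence defined by $s(0)=0$, $s(2n) = -s(n)$ for $n \geq 1$, and $s(2n+1) = s(n)+1$ for $n \geq 0$. -}

module Defs where

open import Data.Nat using (ℕ)
open import Data.Nat.Binary using (ℕᵇ; zero; 2[1+_]; 1+[2_]; fromℕ)
open import Data.Integer using (ℤ; +_; -_; _+_)

-- The infinity series, defined on binary naturals so recursion is structural.
--   2[1+ x ] = 2(x+1),  1+[2 x ] = 2x+1.
-- sᵇ x  = s(x),  sᵇ₁ x = s(x+1)  (mutually recursive helper).
-- Defining equations: s(0) = 0, s(2m) = - s(m) for m ≥ 1, s(2m+1) = s(m) + 1.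
sᵇ  : ℕᵇ → ℤ
sᵇ₁ : ℕᵇ → ℤ
sᵇ zero      = + 0
sᵇ 2[1+ x ]  = - sᵇ₁ x
sᵇ 1+[2 x ]  = sᵇ x + + 1
sᵇ₁ zero     = + 1
sᵇ₁ 2[1+ x ] = sᵇ₁ x + + 1        -- s(2x+3) = s(x+1) + 1
sᵇ₁ 1+[2 x ] = - sᵇ₁ x            -- s(2x+2) = - s(x+1)

s : ℕ → ℤ
s n = sᵇ (fromℕ n)

-- Non-negativity of s(2m) = -s(m) and s(2m+1) = s(m)+1 pins s(m) to {-1,0}.  Five
-- consecutive terms contain such a pair for two consecutive m ≥ 1, so s(m) and
-- s(m+1) would both lie in {-1,0}.  This is impossible: whenever s(x) = -a ≤ 0 we have
-- |s(x+1)| > a, and a short parity case split on m finishes the argument.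
module Submission where

open import Defs
open import Data.Nat using (ℕ; _+_)
open import Data.Integer using (_≤_; +_)
open import Data.Product using (∃-syntax; _×_)
open import Relation.Nullary using (¬_)

open import Data.Nat as ℕ using (zero; suc; s≤s; z≤n; z<s)
import Data.Nat.Properties as ℕ
open import Data.Nat.Binary as ℕᵇ using (zero; 2[1+_]; 1+[2_]; fromℕ')
open import Data.Nat.Binary.Properties using (fromℕ≡fromℕ')
open import Data.Integer using (ℤ; -[1+_]; -_; ∣_∣) renaming (_+_ to _⊕_)
open import Data.Integer.Properties using (neg-injective; ∣-i∣≡∣i∣)
open import Data.Product using (_,_)
open import Data.Empty using (⊥)
open import Function using (_∘_)
open import Relation.Binary.PropositionalEquality

sᵇ-suc : ∀ x → sᵇ (ℕᵇ.suc x) ≡ sᵇ₁ x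
sᵇ-suc zero     = refl
sᵇ-suc 2[1+ x ] = cong (_⊕ + 1) (sᵇ-suc x)
sᵇ-suc 1+[2 x ] = refl

s≡sᵇ∘fromℕ' : ∀ n → s n ≡ sᵇ (fromℕ' n)
s≡sᵇ∘fromℕ' n = cong sᵇ (fromℕ≡fromℕ' n)

-- With the shift on the left, fromℕ' (k + n) unfolds to k applications of ℕᵇ.suc.
s-shift : ∀ n k → s (n + k) ≡ sᵇ (fromℕ' (k + n))
s-shift n k = trans (s≡sᵇ∘fromℕ' (n + k)) (cong (sᵇ ∘ fromℕ') (ℕ.+-comm n k))

z+1≡-a⇒z≡-[1+a] : ∀ z a → z ⊕ + 1 ≡ - + a → z ≡ -[1+ a ]
z+1≡-a⇒z≡-[1+a] (+ zero)        zero    ()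
z+1≡-a⇒z≡-[1+a] (+ zero)        (suc a) ()
z+1≡-a⇒z≡-[1+a] (+ suc n)       zero    ()
z+1≡-a⇒z≡-[1+a] (+ suc n)       (suc a) ()
z+1≡-a⇒z≡-[1+a] -[1+ zero ]     zero    refl = refl
z+1≡-a⇒z≡-[1+a] -[1+ zero ]     (suc a) ()
z+1≡-a⇒z≡-[1+a] -[1+ suc n ]    zero    ()
z+1≡-a⇒z≡-[1+a] -[1+ suc n ]    (suc .n) refl = refl

sᵇ-nonpos⇒∣sᵇ₁∣-grows : ∀ x a → sᵇ x ≡ - + a → a ℕ.< ∣ sᵇ₁ x ∣
sᵇ-nonpos⇒∣sᵇ₁∣-grows zero     zero    refl = z<s
sᵇ-nonpos⇒∣sᵇ₁∣-grows zero     (suc a) ()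
sᵇ-nonpos⇒∣sᵇ₁∣-grows 2[1+ y ] a sx≡-a
  rewrite neg-injective sx≡-a = ℕ.m<m+n a z<s
sᵇ-nonpos⇒∣sᵇ₁∣-grows 1+[2 y ] a sx≡-a = begin-strict
  a              <⟨ ℕ.n<1+n a ⟩
  suc a          <⟨ sᵇ-nonpos⇒∣sᵇ₁∣-grows y (suc a) (z+1≡-a⇒z≡-[1+a] (sᵇ y) a sx≡-a) ⟩
  ∣ sᵇ₁ y ∣      ≡⟨ ∣-i∣≡∣i∣ (sᵇ₁ y) ⟨
  ∣ - sᵇ₁ y ∣    ∎
  where open ℕ.≤-Reasoning

data ∈[-1,0] : ℤ → Set where
  zero      : ∈[-1,0] (+ 0)
  minus-one : ∈[-1,0] -[1+ 0 ]

∈[-1,0]⇒∣∣≤1 : ∀ {z} → ∈[-1,0] z → ∣ z ∣ ℕ.≤ 1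
∈[-1,0]⇒∣∣≤1 zero      = z≤n
∈[-1,0]⇒∣∣≤1 minus-one = s≤s z≤n

-z≥0∧z+1≥0⇒∈[-1,0] : ∀ z → + 0 ≤ - z → + 0 ≤ z ⊕ + 1 → ∈[-1,0] z
-z≥0∧z+1≥0⇒∈[-1,0] (+ zero)        _ _ = zero
-z≥0∧z+1≥0⇒∈[-1,0] -[1+ zero ]     _ _ = minus-one
-z≥0∧z+1≥0⇒∈[-1,0] (+ suc n)       () _
-z≥0∧z+1≥0⇒∈[-1,0] -[1+ suc n ]    _ ()

¬∈[-1,0]-neg-and-suc : ∀ z → ∈[-1,0] (- z) → ∈[-1,0] (z ⊕ + 1) → ⊥
¬∈[-1,0]-neg-and-suc (+ zero)           _  ()
¬∈[-1,0]-neg-and-suc (+ suc zero)       _  ()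
¬∈[-1,0]-neg-and-suc (+ suc (suc n))    () _
¬∈[-1,0]-neg-and-suc -[1+ n ]           () _

∈[-1,0]-suc⇒negative : ∀ {z} → ∈[-1,0] (z ⊕ + 1) → ∃[ a ] z ≡ - + suc a
∈[-1,0]-suc⇒negative {+ zero}              ()
∈[-1,0]-suc⇒negative {+ suc n}             ()
∈[-1,0]-suc⇒negative { -[1+ zero ] }       zero      = 0 , refl
∈[-1,0]-suc⇒negative { -[1+ suc zero ] }   minus-one = 1 , refl
∈[-1,0]-suc⇒negative { -[1+ suc (suc n) ] } ()

¬sᵇ-adjacent-∈[-1,0] : ∀ x → ∈[-1,0] (sᵇ x) → ∈[-1,0] (sᵇ₁ x) → ⊥
¬sᵇ-adjacent-∈[-1,0] zero     _ ()
¬sᵇ-adjacent-∈[-1,0] 2[1+ y ] p q = ¬∈[-1,0]-neg-and-suc (sᵇ₁ y) p q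
¬sᵇ-adjacent-∈[-1,0] 1+[2 y ] p q with ∈[-1,0]-suc⇒negative p
... | a , sy≡-[1+a] = ℕ.<⇒≱ 1<∣sᵇ₁y∣ ∣sᵇ₁y∣≤1
  where
  1<∣sᵇ₁y∣ : 1 ℕ.< ∣ sᵇ₁ y ∣
  1<∣sᵇ₁y∣ = ℕ.≤-trans (s≤s (s≤s z≤n)) (sᵇ-nonpos⇒∣sᵇ₁∣-grows y (suc a) sy≡-[1+a])
  ∣sᵇ₁y∣≤1 : ∣ sᵇ₁ y ∣ ℕ.≤ 1
  ∣sᵇ₁y∣≤1 = subst (ℕ._≤ 1) (∣-i∣≡∣i∣ (sᵇ₁ y)) (∈[-1,0]⇒∣∣≤1 q)

sᵇ-even-odd-nonneg⇒∈[-1,0] : ∀ y → + 0 ≤ sᵇ 2[1+ y ] → + 0 ≤ sᵇ 1+[2 ℕᵇ.suc y ]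
                           → ∈[-1,0] (sᵇ (ℕᵇ.suc y))
sᵇ-even-odd-nonneg⇒∈[-1,0] y p q rewrite sᵇ-suc y = -z≥0∧z+1≥0⇒∈[-1,0] (sᵇ₁ y) p q

¬four-nonneg-from-even : ∀ y → + 0 ≤ sᵇ 2[1+ y ] → + 0 ≤ sᵇ 1+[2 ℕᵇ.suc y ]
                       → + 0 ≤ sᵇ 2[1+ ℕᵇ.suc y ] → + 0 ≤ sᵇ 1+[2 ℕᵇ.suc (ℕᵇ.suc y) ] → ⊥
¬four-nonneg-from-even y p₀ p₁ p₂ p₃ =
  ¬sᵇ-adjacent-∈[-1,0] (ℕᵇ.suc y)
    (sᵇ-even-odd-nonneg⇒∈[-1,0] y p₀ p₁)
    (subst ∈[-1,0] (sᵇ-suc (ℕᵇ.suc y)) (sᵇ-even-odd-nonneg⇒∈[-1,0] (ℕᵇ.suc y) p₂ p₃))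

¬five-nonnegᵇ : ∀ x → + 0 ≤ sᵇ x → + 0 ≤ sᵇ (ℕᵇ.suc x) → + 0 ≤ sᵇ (ℕᵇ.suc (ℕᵇ.suc x))
              → + 0 ≤ sᵇ (ℕᵇ.suc (ℕᵇ.suc (ℕᵇ.suc x)))
              → + 0 ≤ sᵇ (ℕᵇ.suc (ℕᵇ.suc (ℕᵇ.suc (ℕᵇ.suc x)))) → ⊥
¬five-nonnegᵇ zero     _  _  () _  _
¬five-nonnegᵇ 2[1+ y ] p₀ p₁ p₂ p₃ _  = ¬four-nonneg-from-even y p₀ p₁ p₂ p₃
¬five-nonnegᵇ 1+[2 y ] _  p₁ p₂ p₃ p₄ = ¬four-nonneg-from-even y p₁ p₂ p₃ p₄

corollary9 : ¬ (∃[ n ] ((+ 0 ≤ s n) × (+ 0 ≤ s (n + 1)) × (+ 0 ≤ s (n + 2))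
    × (+ 0 ≤ s (n + 3)) × (+ 0 ≤ s (n + 4))))
corollary9 (n , p₀ , p₁ , p₂ , p₃ , p₄) =
  ¬five-nonnegᵇ (fromℕ' n) (nonneg (s≡sᵇ∘fromℕ' n) p₀)
    (nonneg (s-shift n 1) p₁) (nonneg (s-shift n 2) p₂)
    (nonneg (s-shift n 3) p₃) (nonneg (s-shift n 4) p₄)
  where
  nonneg : ∀ {i j} → i ≡ j → + 0 ≤ i → + 0 ≤ j
  nonneg = subst (+ 0 ≤_)
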